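{- Let $\lambda\in\mathbf{C}$ with $\lambda\neq 0$ and $\lambda\neq 1$. For every $n\in\mathbf{Z}_{+}$, $$\lambda H_{n}(x\vert\lambda^{ -1})+H_{n}(x\vert\lambda)=(1+\lambda)\sum_{k=0}^{n}\binom{n}{k}H_{n-k}(\lambda^{ -1})H_{k}(x\vert\lambda).$$
   Context: For $\mu\in\mathbf{C}$, $\mu\neq1$, the Frobenius–Euler polynomials $H_n(x\vert\mu)$ are defined by $\frac{1-\mu}{e^{t}-\mu}e^{xt}=\sum_{n=0}^{\infty}H_{n}(x\vert\mu)\frac{t^{n}}{n!}$, and the Frobenius–Euler numbers are $H_n(\mu)=H_n(0\vert\mu)$. $\mathbf{Z}_+$ denotes the nonnegative integers. -}

module Defs where

open import Level using (_⊔_)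
open import Data.Nat using (ℕ; zero; suc; _∸_)
open import Data.Nat.Combinatorics using (_C_)
open import Data.Product using (Σ; _×_)
open import Relation.Nullary using (¬_)
open import Algebra.Bundles using (CommutativeRing)

module FE {c ℓ} (R : CommutativeRing c ℓ) where
  open CommutativeRing R

  fromℕ : ℕ → Carrier
  fromℕ zero = 0#
  fromℕ (suc n) = 1# + fromℕ n

  _^_ : Carrier → ℕ → Carrier
  x ^ zero = 1#
  x ^ suc n = x * (x ^ n)

  sumTo : ℕ → (ℕ → Carrier) → Carrier
  sumTo zero f = f 0
  sumTo (suc n) f = sumTo n f + f (suc n)

  IsCharZeroField : Set (c ⊔ ℓ)
  IsCharZeroField =
    (¬ (1# ≈ 0#))
    × (∀ (a : Carrier) → ¬ (a ≈ 0#) → Σ Carrier (λ b → a * b ≈ 1#))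
    × (∀ (n : ℕ) → ¬ (fromℕ (suc n) ≈ 0#))

  -- H is the family of Frobenius–Euler polynomials H_n(x | μ), i.e.
  --   (1 - μ) e^{xt} = (e^t - μ) Σ_n H_n(x|μ) t^n / n!
  -- as exponential generating functions; comparing n! [t^n] on both sides
  -- (legitimate in characteristic 0) gives, for all n and x,
  --   (1 - μ) x^n = Σ_{k=0}^n C(n,k) H_k(x|μ) - μ H_n(x|μ).
  IsFrobeniusEuler : Carrier → (ℕ → Carrier → Carrier) → Set (c ⊔ ℓ)
  IsFrobeniusEuler μ H =
    ∀ (n : ℕ) (x : Carrier) →
      (1# - μ) * (x ^ n) ≈ (sumTo n (λ k → fromℕ (n C k) * H k x) - μ * H n x)

{-# OPTIONS --safe #-}

-- Work in the ring of exponential generating functions Σ aₙ tⁿ/n! over R, i.e. sequences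
-- under binomial convolution. The defining relation of Hₙ(x|μ) reads
-- (eᵗ - μ) F_μ = (1 - μ) e^{xt} with F_μ = Σ Hₙ(x|μ) tⁿ/n!. Multiplying the relation for
-- μ = λ⁻¹ by λ gives (λeᵗ - 1) F_{λ⁻¹} = (λ - 1) e^{xt}, and at x = 0 also
-- (λeᵗ - 1) G = λ - 1 for G = Σ Hₙ(λ⁻¹) tⁿ/n!. Substituting these three relations shows that
-- (λeᵗ - 1)(eᵗ - λ) kills D = λ F_{λ⁻¹} + F_λ - (1 + λ) G F_λ. Both factors have invertible
-- constant terms λ - 1 and 1 - λ, hence are not zero divisors, so D = 0; its n-th
-- coefficient is the theorem.
module Submission where

open import Defs
open import Data.Nat using (ℕ; _∸_)
open import Data.Nat.Combinatorics using (_C_)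
open import Relation.Nullary using (¬_)
open import Algebra.Bundles using (CommutativeRing)

open import Data.Nat as ℕ using (zero; suc; _≤_; _<_; z≤n; s≤s)
open import Data.Nat.Properties using (m≤n⇒m≤1+n; ≤-refl; n<1+n; +-∸-assoc; n∸n≡0)
open import Data.Nat.Combinatorics using (nCk+nC[k+1]≡[n+1]C[k+1]; nCn≡1; k>n⇒nCk≡0)
open import Data.Nat.Induction using (<-rec)
open import Data.Product using (Σ; _×_; _,_)
open import Data.Product.Properties using (≡-dec)
open import Data.Maybe using (just; nothing)
open import Level using (0ℓ)
open import Relation.Nullary using (yes; no)
open import Relation.Binary.Definitions using (WeaklyDecidable)
open import Relation.Binary.PropositionalEquality as ≡ using (_≡_)
open import Algebra.Bundles using (RawRing)
open import Algebra.Solver.Ring.AlmostCommutativeRing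
  using (fromCommutativeRing; _-Raw-AlmostCommutative⟶_)
import Algebra.Construct.Pointwise as Pointwise
import Algebra.Properties.Ring as RingProperties

module IntegerSolver {c ℓ} (R : CommutativeRing c ℓ) where
  open CommutativeRing R
  open import Relation.Binary.Reasoning.Setoid setoid
  open import Algebra.Properties.Ring ring using ([y-z]x≈yx-zx; x[y-z]≈xy-xz)
  open import Algebra.Properties.AbelianGroup +-abelianGroup using (⁻¹-∙-comm; ⁻¹-anti-homo‿-)
  open import Algebra.Properties.CommutativeSemigroup +-commutativeSemigroup using (interchange)
  open import Algebra.Properties.Semiring.Mult.TCOptimised semiring
    using (×1-homo-*; ×-homo-+) renaming (_×_ to _·_)

  -- A coefficient (p , q) is the integer p - q; normalised pairs represent
  -- each integer uniquely, so ≡ decides equality of coefficients.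
  normalise : ℕ → ℕ → ℕ × ℕ
  normalise p q = (p ∸ q , q ∸ p)

  integers : RawRing 0ℓ 0ℓ
  integers = record
    { Carrier = ℕ × ℕ
    ; _≈_ = _≡_
    ; _+_ = λ { (p , q) (p′ , q′) → normalise (p ℕ.+ p′) (q ℕ.+ q′) }
    ; _*_ = λ { (p , q) (p′ , q′) → normalise (p ℕ.* p′ ℕ.+ q ℕ.* q′) (p ℕ.* q′ ℕ.+ q ℕ.* p′) }
    ; -_ = λ { (p , q) → (q , p) }
    ; 0# = (0 , 0)
    ; 1# = (1 , 0)
    }

  ι : ℕ → Carrier
  ι n = n · 1#

  -- Nonnegative coefficients are sent to ι p itself, so that :1 denotes 1# on the nose.
  ⟦_⟧ : ℕ × ℕ → Carrier
  ⟦ p , zero  ⟧ = ι p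
  ⟦ p , suc q ⟧ = ι p - ι (suc q)

  -‿+ : ∀ x y → - (x + y) ≈ - x + - y
  -‿+ x y = sym (⁻¹-∙-comm x y)

  -0≈0 : - 0# ≈ 0#
  -0≈0 = trans (sym (+-identityˡ _)) (-‿inverseʳ 0#)

  ⟦⟧≈ι-ι : ∀ p q → ⟦ p , q ⟧ ≈ ι p - ι q
  ⟦⟧≈ι-ι p zero    = sym (trans (+-congˡ -0≈0) (+-identityʳ (ι p)))
  ⟦⟧≈ι-ι p (suc q) = refl

  +-‿interchange : ∀ x y z w → (x + z) - (y + w) ≈ (x - y) + (z - w)
  +-‿interchange x y z w = trans (+-congˡ (-‿+ y w)) (interchange x z (- y) (- w))

  ⟦normalise⟧ : ∀ p q → ⟦ normalise p q ⟧ ≈ ι p - ι q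
  ⟦normalise⟧ zero    zero    = ⟦⟧≈ι-ι 0 0
  ⟦normalise⟧ zero    (suc q) = refl
  ⟦normalise⟧ (suc p) zero    = ⟦⟧≈ι-ι (suc p) 0
  ⟦normalise⟧ (suc p) (suc q) = begin
    ⟦ normalise p q ⟧                       ≈⟨ ⟦normalise⟧ p q ⟩
    ι p - ι q                               ≈⟨ +-identityˡ _ ⟨
    0# + (ι p - ι q)                        ≈⟨ +-congʳ (-‿inverseʳ 1#) ⟨
    (1# - 1#) + (ι p - ι q)                 ≈⟨ +-‿interchange 1# 1# (ι p) (ι q) ⟨
    (1# + ι p) - (1# + ι q)                 ≈⟨ +-cong (×-homo-+ 1# 1 p) (-‿cong (×-homo-+ 1# 1 q)) ⟨
    ι (suc p) - ι (suc q)                   ∎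

  [x-y][z-w] : ∀ x y z w → (x - y) * (z - w) ≈ (x * z + y * w) - (x * w + y * z)
  [x-y][z-w] x y z w = begin
    (x - y) * (z - w)                         ≈⟨ [y-z]x≈yx-zx (z - w) x y ⟩
    x * (z - w) - y * (z - w)                 ≈⟨ +-cong (x[y-z]≈xy-xz x z w) (-‿cong (x[y-z]≈xy-xz y z w)) ⟩
    (x * z - x * w) + - (y * z - y * w)       ≈⟨ +-congˡ (⁻¹-anti-homo‿- (y * z) (y * w)) ⟩
    (x * z - x * w) + (y * w - y * z)         ≈⟨ interchange _ _ _ _ ⟩
    (x * z + y * w) + (- (x * w) + - (y * z)) ≈⟨ +-congˡ (-‿+ _ _) ⟨
    (x * z + y * w) - (x * w + y * z)         ∎

  morphism : integers -Raw-AlmostCommutative⟶ fromCommutativeRing R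
  morphism = record
    { ⟦_⟧ = ⟦_⟧
    ; +-homo = λ { (p , q) (p′ , q′) → begin
        ⟦ normalise (p ℕ.+ p′) (q ℕ.+ q′) ⟧   ≈⟨ ⟦normalise⟧ (p ℕ.+ p′) (q ℕ.+ q′) ⟩
        ι (p ℕ.+ p′) - ι (q ℕ.+ q′)           ≈⟨ +-cong (×-homo-+ 1# p p′) (-‿cong (×-homo-+ 1# q q′)) ⟩
        (ι p + ι p′) - (ι q + ι q′)           ≈⟨ +-‿interchange _ _ _ _ ⟩
        (ι p - ι q) + (ι p′ - ι q′)           ≈⟨ +-cong (⟦⟧≈ι-ι p q) (⟦⟧≈ι-ι p′ q′) ⟨
        ⟦ p , q ⟧ + ⟦ p′ , q′ ⟧               ∎ }
    ; *-homo = λ { (p , q) (p′ , q′) → begin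
        ⟦ normalise (p ℕ.* p′ ℕ.+ q ℕ.* q′) (p ℕ.* q′ ℕ.+ q ℕ.* p′) ⟧
          ≈⟨ ⟦normalise⟧ (p ℕ.* p′ ℕ.+ q ℕ.* q′) (p ℕ.* q′ ℕ.+ q ℕ.* p′) ⟩
        ι (p ℕ.* p′ ℕ.+ q ℕ.* q′) - ι (p ℕ.* q′ ℕ.+ q ℕ.* p′)
          ≈⟨ +-cong (trans (×-homo-+ 1# (p ℕ.* p′) (q ℕ.* q′)) (+-cong (×1-homo-* p p′) (×1-homo-* q q′)))
                    (-‿cong (trans (×-homo-+ 1# (p ℕ.* q′) (q ℕ.* p′)) (+-cong (×1-homo-* p q′) (×1-homo-* q p′)))) ⟩
        (ι p * ι p′ + ι q * ι q′) - (ι p * ι q′ + ι q * ι p′) ≈⟨ [x-y][z-w] _ _ _ _ ⟨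
        (ι p - ι q) * (ι p′ - ι q′)           ≈⟨ *-cong (⟦⟧≈ι-ι p q) (⟦⟧≈ι-ι p′ q′) ⟨
        ⟦ p , q ⟧ * ⟦ p′ , q′ ⟧               ∎ }
    ; -‿homo = λ { (p , q) → begin
        ⟦ q , p ⟧       ≈⟨ ⟦⟧≈ι-ι q p ⟩
        ι q - ι p       ≈⟨ ⁻¹-anti-homo‿- (ι p) (ι q) ⟨
        - (ι p - ι q)   ≈⟨ -‿cong (⟦⟧≈ι-ι p q) ⟨
        - ⟦ p , q ⟧     ∎ }
    ; 0-homo = refl
    ; 1-homo = refl
    }

  ⟦⟧-≟ : WeaklyDecidable (λ i j → ⟦ i ⟧ ≈ ⟦ j ⟧)
  ⟦⟧-≟ i j with ≡-dec ℕ._≟_ ℕ._≟_ i j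
  ... | yes ≡.refl = just refl
  ... | no _       = nothing

  open import Algebra.Solver.Ring integers (fromCommutativeRing R) morphism ⟦⟧-≟
    public using (Polynomial; solve; _:=_; _:+_; _:*_; _:-_; con)

  :1 : ∀ {n} → Polynomial n
  :1 = con (1 , 0)


module ProductFormulaAlgebra {c ℓ} (T : CommutativeRing c ℓ) where
  open CommutativeRing T
  open IntegerSolver T
  open import Relation.Binary.Reasoning.Setoid setoid

  rescale-by-inverse : ∀ {l m e X G} → l * m ≈ 1# →
    (e - m) * G ≈ (1# - m) * X → (l * e - 1#) * G ≈ (l - 1#) * X
  rescale-by-inverse {l} {m} {e} {X} {G} lm≈1 eG = begin
    (l * e - 1#) * G      ≈⟨ *-congʳ (+-congˡ (-‿cong lm≈1)) ⟨
    (l * e - l * m) * G   ≈⟨ factor l e m G ⟩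
    l * ((e - m) * G)     ≈⟨ *-congˡ eG ⟩
    l * ((1# - m) * X)    ≈⟨ factor l 1# m X ⟨
    (l * 1# - l * m) * X  ≈⟨ *-congʳ (+-cong (*-identityʳ l) (-‿cong lm≈1)) ⟩
    (l - 1#) * X          ∎
    where
    factor : ∀ l a b y → (l * a - l * b) * y ≈ l * ((a - b) * y)
    factor = solve 4 (λ l a b y → (l :* a :- l :* b) :* y := l :* ((a :- b) :* y)) refl

  -- Read l = λ, e = eᵗ, X = e^{xt}, F = Σ Hₙ(x|λ) tⁿ/n!, G = Σ Hₙ(x|λ⁻¹) tⁿ/n!, g = Σ Hₙ(λ⁻¹) tⁿ/n!.
  annihilate-product-formula : ∀ {l e X F G g} →
    (e - l) * F ≈ (1# - l) * X →
    (l * e - 1#) * G ≈ (l - 1#) * X →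
    (l * e - 1#) * g ≈ l - 1# →
    (l * e - 1#) * ((e - l) * ((l * G + F) - (1# + l) * (g * F))) ≈ 0#
  annihilate-product-formula {l} {e} {X} {F} {G} {g} eF eG eg = begin
    (l * e - 1#) * ((e - l) * ((l * G + F) - (1# + l) * (g * F)))
      ≈⟨ expand l e F G g ⟩
    (l * (e - l) * ((l * e - 1#) * G) + (l * e - 1#) * ((e - l) * F))
      - (1# + l) * ((l * e - 1#) * g) * ((e - l) * F)
      ≈⟨ +-cong (+-cong (*-congˡ eG) (*-congˡ eF)) (-‿cong (*-cong (*-congˡ eg) eF)) ⟩
    (l * (e - l) * ((l - 1#) * X) + (l * e - 1#) * ((1# - l) * X))
      - (1# + l) * (l - 1#) * ((1# - l) * X)
      ≈⟨ vanish l e X ⟩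
    0# ∎
    where
    expand : ∀ l e F G g →
      (l * e - 1#) * ((e - l) * ((l * G + F) - (1# + l) * (g * F)))
        ≈ (l * (e - l) * ((l * e - 1#) * G) + (l * e - 1#) * ((e - l) * F))
          - (1# + l) * ((l * e - 1#) * g) * ((e - l) * F)
    expand = solve 5 (λ l e F G g →
      (l :* e :- :1) :* ((e :- l) :* ((l :* G :+ F) :- (:1 :+ l) :* (g :* F)))
        := (l :* (e :- l) :* ((l :* e :- :1) :* G) :+ (l :* e :- :1) :* ((e :- l) :* F))
           :- (:1 :+ l) :* ((l :* e :- :1) :* g) :* ((e :- l) :* F)) refl
    vanish : ∀ l e X →
      (l * (e - l) * ((l - 1#) * X) + (l * e - 1#) * ((1# - l) * X))
        - (1# + l) * (l - 1#) * ((1# - l) * X) ≈ 0#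
    vanish = solve 3 (λ l e X →
      (l :* (e :- l) :* ((l :- :1) :* X) :+ (l :* e :- :1) :* ((:1 :- l) :* X))
        :- (:1 :+ l) :* (l :- :1) :* ((:1 :- l) :* X) := con (0 , 0)) refl

module ExponentialSeries {c ℓ} (R : CommutativeRing c ℓ) where
  open CommutativeRing R
  open FE R
  open import Relation.Binary.Reasoning.Setoid setoid
  open import Algebra.Properties.CommutativeSemigroup +-commutativeSemigroup using (interchange; x∙yz≈xz∙y)

  sumTo-cong : ∀ n {f g : ℕ → Carrier} → (∀ k → k ≤ n → f k ≈ g k) → sumTo n f ≈ sumTo n g
  sumTo-cong zero    f≈g = f≈g 0 z≤n
  sumTo-cong (suc n) f≈g = +-cong (sumTo-cong n (λ k k≤n → f≈g k (m≤n⇒m≤1+n k≤n))) (f≈g (suc n) ≤-refl)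

  sumTo-+ : ∀ n (f g : ℕ → Carrier) → sumTo n (λ k → f k + g k) ≈ sumTo n f + sumTo n g
  sumTo-+ zero    f g = refl
  sumTo-+ (suc n) f g = trans (+-congʳ (sumTo-+ n f g)) (interchange _ _ _ _)

  sumTo-zero : ∀ n {f : ℕ → Carrier} → (∀ k → k ≤ n → f k ≈ 0#) → sumTo n f ≈ 0#
  sumTo-zero n f≈0 = trans (sumTo-cong n f≈0) (sumTo-const0 n)
    where
    sumTo-const0 : ∀ n → sumTo n (λ _ → 0#) ≈ 0#
    sumTo-const0 zero    = refl
    sumTo-const0 (suc n) = trans (+-congʳ (sumTo-const0 n)) (+-identityʳ 0#)

  sumTo-last : ∀ n {f : ℕ → Carrier} → (∀ k → k < n → f k ≈ 0#) → sumTo n f ≈ f n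
  sumTo-last zero    _   = refl
  sumTo-last (suc n) f≈0 = trans (+-congʳ (sumTo-zero n (λ k k≤n → f≈0 k (s≤s k≤n)))) (+-identityˡ _)

  sumTo-head : ∀ n (f : ℕ → Carrier) → sumTo (suc n) f ≈ f 0 + sumTo n (λ k → f (suc k))
  sumTo-head zero    f = refl
  sumTo-head (suc n) f = trans (+-congʳ (sumTo-head n f)) (+-assoc _ _ _)

  fromℕ-+ : ∀ m n → fromℕ (m ℕ.+ n) ≈ fromℕ m + fromℕ n
  fromℕ-+ zero    n = sym (+-identityˡ _)
  fromℕ-+ (suc m) n = trans (+-congˡ (fromℕ-+ m n)) (sym (+-assoc _ _ _))

  fromℕ-1 : fromℕ 1 ≈ 1#
  fromℕ-1 = +-identityʳ 1#

  Seq : Set c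
  Seq = ℕ → Carrier

  infix 4 _≋_
  _≋_ : Seq → Seq → Set ℓ
  a ≋ b = ∀ n → a n ≈ b n

  infixl 6 _⊕_
  _⊕_ : Seq → Seq → Seq
  (a ⊕ b) n = a n + b n

  -- Binomial convolution: the product of exponential generating functions Σ aₙ tⁿ/n!.
  infixl 7 _⋆_
  _⋆_ : Seq → Seq → Seq
  (a ⋆ b) n = sumTo n (λ k → fromℕ (n C k) * (a (n ∸ k) * b k))

  -- The derivative of an exponential generating function.
  shift : Seq → Seq
  shift a n = a (suc n)

  scalar : Carrier → Seq
  scalar x zero    = x
  scalar x (suc n) = 0#

  ⋆-cong : ∀ {a a′ b b′} → a ≋ a′ → b ≋ b′ → a ⋆ b ≋ a′ ⋆ b′
  ⋆-cong a≋a′ b≋b′ n = sumTo-cong n (λ k _ → *-congˡ (*-cong (a≋a′ (n ∸ k)) (b≋b′ k)))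

  ⋆-congˡ : ∀ {a b b′} → b ≋ b′ → a ⋆ b ≋ a ⋆ b′
  ⋆-congˡ {a} = ⋆-cong {a} (λ _ → refl)

  ⋆-congʳ : ∀ {a a′ b} → a ≋ a′ → a ⋆ b ≋ a′ ⋆ b
  ⋆-congʳ a≋a′ = ⋆-cong a≋a′ (λ _ → refl)

  ⋆-distribˡ : ∀ a b b′ → a ⋆ (b ⊕ b′) ≋ a ⋆ b ⊕ a ⋆ b′
  ⋆-distribˡ a b b′ n = trans (sumTo-cong n (λ k _ → split _ _ _ _)) (sumTo-+ n _ _)
    where
    split : ∀ x y z w → x * (y * (z + w)) ≈ x * (y * z) + x * (y * w)
    split x y z w = trans (*-congˡ (distribˡ y z w)) (distribˡ x _ _)

  ⋆-distribʳ : ∀ a b b′ → (b ⊕ b′) ⋆ a ≋ b ⋆ a ⊕ b′ ⋆ a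
  ⋆-distribʳ a b b′ n = trans (sumTo-cong n (λ k _ → split _ _ _ _)) (sumTo-+ n _ _)
    where
    split : ∀ x y z w → x * ((z + w) * y) ≈ x * (z * y) + x * (w * y)
    split x y z w = trans (*-congˡ (distribʳ y z w)) (distribˡ x _ _)

  ⋆-head : ∀ a b → (a ⋆ b) 0 ≈ a 0 * b 0
  ⋆-head a b = trans (*-congʳ fromℕ-1) (*-identityˡ _)

  shiftˡ-⋆ : ∀ a b n → (shift a ⋆ b) n
    ≈ fromℕ (suc n C 0) * (a (suc n) * b 0) + sumTo n (λ k → fromℕ (n C suc k) * (a (n ∸ k) * b (suc k)))
  shiftˡ-⋆ a b n = begin
    (shift a ⋆ b) n
      ≈⟨ sumTo-cong n (λ k k≤n → *-congˡ (*-congʳ (reflexive (≡.cong a (≡.sym (+-∸-assoc 1 k≤n)))))) ⟩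
    sumTo n g                 ≈⟨ +-identityʳ _ ⟨
    sumTo n g + 0#            ≈⟨ +-congˡ g[1+n]≈0 ⟨
    sumTo (suc n) g           ≈⟨ sumTo-head n g ⟩
    g 0 + sumTo n (λ k → g (suc k)) ∎
    where
    g : ℕ → Carrier
    g k = fromℕ (n C k) * (a (suc n ∸ k) * b k)
    g[1+n]≈0 : g (suc n) ≈ 0#
    g[1+n]≈0 = trans (*-congʳ (reflexive (≡.cong fromℕ (k>n⇒nCk≡0 (n<1+n n))))) (zeroˡ _)

  shift-⋆ : ∀ a b → shift (a ⋆ b) ≋ shift a ⋆ b ⊕ a ⋆ shift b
  shift-⋆ a b n = begin
    (a ⋆ b) (suc n)                       ≈⟨ sumTo-head n f ⟩
    f 0 + sumTo n (λ k → f (suc k))       ≈⟨ +-congˡ (trans (sumTo-cong n (λ k _ → pascal k)) (sumTo-+ n p q)) ⟩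
    f 0 + (sumTo n p + sumTo n q)         ≈⟨ x∙yz≈xz∙y _ _ _ ⟩
    (f 0 + sumTo n q) + sumTo n p         ≈⟨ +-congʳ (shiftˡ-⋆ a b n) ⟨
    (shift a ⋆ b) n + (a ⋆ shift b) n     ∎
    where
    f p q : ℕ → Carrier
    f k = fromℕ (suc n C k) * (a (suc n ∸ k) * b k)
    p k = fromℕ (n C k) * (a (n ∸ k) * b (suc k))
    q k = fromℕ (n C suc k) * (a (n ∸ k) * b (suc k))
    pascal : ∀ k → f (suc k) ≈ p k + q k
    pascal k = trans (*-congʳ (trans (reflexive (≡.cong fromℕ (≡.sym (nCk+nC[k+1]≡[n+1]C[k+1] n k))))
                                     (fromℕ-+ (n C k) (n C suc k))))
                     (distribʳ _ _ _)

  scalar-⋆ : ∀ x a → scalar x ⋆ a ≋ (λ n → x * a n)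
  scalar-⋆ x a zero    = ⋆-head (scalar x) a
  scalar-⋆ x a (suc n) = begin
    (scalar x ⋆ a) (suc n)                             ≈⟨ shift-⋆ (scalar x) a n ⟩
    (shift (scalar x) ⋆ a) n + (scalar x ⋆ shift a) n  ≈⟨ +-cong 0⋆a≈0 (scalar-⋆ x (shift a) n) ⟩
    0# + x * a (suc n)                                 ≈⟨ +-identityˡ _ ⟩
    x * a (suc n)                                      ∎
    where
    0⋆a≈0 : ((λ _ → 0#) ⋆ a) n ≈ 0#
    0⋆a≈0 = sumTo-zero n (λ k _ → trans (*-congˡ (zeroˡ _)) (zeroʳ _))

  ⋆-comm : ∀ a b → a ⋆ b ≋ b ⋆ a
  ⋆-comm a b zero    = *-congˡ (*-comm (a 0) (b 0))
  ⋆-comm a b (suc n) = begin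
    (a ⋆ b) (suc n)                     ≈⟨ shift-⋆ a b n ⟩
    (shift a ⋆ b) n + (a ⋆ shift b) n   ≈⟨ +-cong (⋆-comm (shift a) b n) (⋆-comm a (shift b) n) ⟩
    (b ⋆ shift a) n + (shift b ⋆ a) n   ≈⟨ +-comm _ _ ⟩
    (shift b ⋆ a) n + (b ⋆ shift a) n   ≈⟨ shift-⋆ b a n ⟨
    (b ⋆ a) (suc n)                     ∎

  ⋆-assoc : ∀ a b d → (a ⋆ b) ⋆ d ≋ a ⋆ (b ⋆ d)
  ⋆-assoc a b d zero = begin
    ((a ⋆ b) ⋆ d) 0     ≈⟨ trans (⋆-head (a ⋆ b) d) (*-congʳ (⋆-head a b)) ⟩
    (a 0 * b 0) * d 0   ≈⟨ *-assoc _ _ _ ⟩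
    a 0 * (b 0 * d 0)   ≈⟨ trans (⋆-head a (b ⋆ d)) (*-congˡ (⋆-head b d)) ⟨
    (a ⋆ (b ⋆ d)) 0     ∎
  ⋆-assoc a b d (suc n) = begin
    ((a ⋆ b) ⋆ d) (suc n)
      ≈⟨ shift-⋆ (a ⋆ b) d n ⟩
    (shift (a ⋆ b) ⋆ d) n + ((a ⋆ b) ⋆ shift d) n
      ≈⟨ +-congʳ (trans (⋆-cong (shift-⋆ a b) (λ _ → refl) n) (⋆-distribʳ d (shift a ⋆ b) (a ⋆ shift b) n)) ⟩
    (((shift a ⋆ b) ⋆ d) n + ((a ⋆ shift b) ⋆ d) n) + ((a ⋆ b) ⋆ shift d) n
      ≈⟨ +-cong (+-cong (⋆-assoc (shift a) b d n) (⋆-assoc a (shift b) d n)) (⋆-assoc a b (shift d) n) ⟩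
    ((shift a ⋆ (b ⋆ d)) n + (a ⋆ (shift b ⋆ d)) n) + (a ⋆ (b ⋆ shift d)) n
      ≈⟨ +-assoc _ _ _ ⟩
    (shift a ⋆ (b ⋆ d)) n + ((a ⋆ (shift b ⋆ d)) n + (a ⋆ (b ⋆ shift d)) n)
      ≈⟨ +-congˡ (trans (⋆-cong {a = a} (λ _ → refl) (shift-⋆ b d) n) (⋆-distribˡ a (shift b ⋆ d) (b ⋆ shift d) n)) ⟨
    (shift a ⋆ (b ⋆ d)) n + (a ⋆ shift (b ⋆ d)) n
      ≈⟨ shift-⋆ a (b ⋆ d) n ⟨
    (a ⋆ (b ⋆ d)) (suc n) ∎

  ⋆-identityˡ : ∀ a → scalar 1# ⋆ a ≋ a
  ⋆-identityˡ a n = trans (scalar-⋆ 1# a n) (*-identityˡ (a n))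

  egfRing : CommutativeRing c ℓ
  egfRing = record
    { Carrier = Seq
    ; _≈_ = _≋_
    ; _+_ = _⊕_
    ; _*_ = _⋆_
    ; -_ = λ a n → - a n
    ; 0# = λ _ → 0#
    ; 1# = scalar 1#
    ; isCommutativeRing = record
      { isRing = record
        { +-isAbelianGroup = Pointwise.isAbelianGroup ℕ +-isAbelianGroup
        ; *-cong = ⋆-cong
        ; *-assoc = ⋆-assoc
        ; *-identity = ⋆-identityˡ , (λ a n → trans (⋆-comm a (scalar 1#) n) (⋆-identityˡ a n))
        ; distrib = ⋆-distribˡ , ⋆-distribʳ
        }
      ; *-comm = ⋆-comm
      }
    }

  w⋆d≈0⇒d≈0 : ∀ {w d : Seq} → Σ Carrier (λ v → w 0 * v ≈ 1#) → w ⋆ d ≋ (λ _ → 0#) → d ≋ (λ _ → 0#)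
  w⋆d≈0⇒d≈0 {w} {d} (v , w₀v≈1) wd≈0 = <-rec (λ n → d n ≈ 0#) step
    where
    step : ∀ n → (∀ {k} → k < n → d k ≈ 0#) → d n ≈ 0#
    step n ih = begin
      d n                  ≈⟨ *-identityˡ _ ⟨
      1# * d n             ≈⟨ *-congʳ (trans (*-comm v (w 0)) w₀v≈1) ⟨
      (v * w 0) * d n      ≈⟨ *-assoc _ _ _ ⟩
      v * (w 0 * d n)      ≈⟨ *-congˡ wd≈w₀dn ⟨
      v * (w ⋆ d) n        ≈⟨ *-congˡ (wd≈0 n) ⟩
      v * 0#               ≈⟨ zeroʳ v ⟩
      0#                   ∎
      where
      wd≈w₀dn : (w ⋆ d) n ≈ w 0 * d n
      wd≈w₀dn = begin
        (w ⋆ d) n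
          ≈⟨ sumTo-last n (λ k k<n → trans (*-congˡ (trans (*-congˡ (ih k<n)) (zeroʳ _))) (zeroʳ _)) ⟩
        fromℕ (n C n) * (w (n ∸ n) * d n)      ≈⟨ *-cong (trans (reflexive (≡.cong fromℕ (nCn≡1 n))) fromℕ-1)
                                                         (*-congʳ (reflexive (≡.cong w (n∸n≡0 n)))) ⟩
        1# * (w 0 * d n)                       ≈⟨ *-identityˡ _ ⟩
        w 0 * d n                              ∎

module FrobeniusEulerSeries {c ℓ} (R : CommutativeRing c ℓ) where
  open CommutativeRing R
  open FE R
  open ExponentialSeries R
  open import Relation.Binary.Reasoning.Setoid setoid
  private module E = CommutativeRing egfRing
  open import Algebra.Properties.Group E.+-group using (x∙y⁻¹≈ε⇒x≈y)
  open import Algebra.Properties.Group +-group using () renaming (x∙y⁻¹≈ε⇒x≈y to x-y≈0⇒x≈y)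

  ones : Seq
  ones _ = 1#

  powers : Carrier → Seq
  powers x n = x ^ n

  series : (ℕ → Carrier → Carrier) → Carrier → Seq
  series H x n = H n x

  isFrobeniusEuler⇒egf : ∀ {μ H} → IsFrobeniusEuler μ H → ∀ x →
    (ones E.- scalar μ) ⋆ series H x ≋ (E.1# E.- scalar μ) ⋆ powers x
  isFrobeniusEuler⇒egf {μ} {H} isFE x n = begin
    ((ones E.- scalar μ) ⋆ series H x) n
      ≈⟨ RingProperties.[y-z]x≈yx-zx E.ring (series H x) ones (scalar μ) n ⟩
    (ones ⋆ series H x) n - (scalar μ ⋆ series H x) n
      ≈⟨ +-cong (sumTo-cong n (λ k _ → *-congˡ (*-identityˡ _))) (-‿cong (scalar-⋆ μ (series H x) n)) ⟩
    sumTo n (λ k → fromℕ (n C k) * H k x) - μ * H n x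
      ≈⟨ isFE n x ⟨
    (1# - μ) * x ^ n
      ≈⟨ RingProperties.[y-z]x≈yx-zx ring (x ^ n) 1# μ ⟩
    1# * x ^ n - μ * x ^ n
      ≈⟨ +-cong (scalar-⋆ 1# (powers x) n) (-‿cong (scalar-⋆ μ (powers x) n)) ⟨
    (E.1# ⋆ powers x) n - (scalar μ ⋆ powers x) n
      ≈⟨ RingProperties.[y-z]x≈yx-zx E.ring (powers x) E.1# (scalar μ) n ⟨
    ((E.1# E.- scalar μ) ⋆ powers x) n ∎

  powers-0 : powers 0# ≋ E.1#
  powers-0 zero    = refl
  powers-0 (suc n) = zeroˡ _

  scalar-⋆-scalar : ∀ a b → scalar a ⋆ scalar b ≋ scalar (a * b)
  scalar-⋆-scalar a b zero    = scalar-⋆ a (scalar b) 0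
  scalar-⋆-scalar a b (suc n) = trans (scalar-⋆ a (scalar b) (suc n)) (zeroʳ a)

  scalar-cong : ∀ {a b} → a ≈ b → scalar a ≋ scalar b
  scalar-cong a≈b zero    = a≈b
  scalar-cong a≈b (suc n) = refl

  scalar-⊕ : ∀ a b → scalar a ⊕ scalar b ≋ scalar (a + b)
  scalar-⊕ a b zero    = refl
  scalar-⊕ a b (suc n) = +-identityʳ 0#

  product-formula-egf : (∀ a → ¬ (a ≈ 0#) → Σ Carrier (λ b → a * b ≈ 1#)) →
    ∀ {lam lamInv} → lam * lamInv ≈ 1# → ¬ (lam ≈ 1#) →
    ∀ {H H′} → IsFrobeniusEuler lam H → IsFrobeniusEuler lamInv H′ → ∀ x →
    scalar lam ⋆ series H′ x ⊕ series H x
      ≋ scalar (1# + lam) ⋆ (series H′ 0# ⋆ series H x)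
  product-formula-egf inverse {lam} {lamInv} inv lam≉1 {H} {H′} isFE isFE′ x =
    E.trans (x∙y⁻¹≈ε⇒x≈y _ _ D≈0) (⋆-congʳ (scalar-⊕ 1# lam))
    where
    open ProductFormulaAlgebra egfRing
    L u v D : Seq
    L = scalar lam
    u = L ⋆ ones E.- E.1#
    v = ones E.- L
    D = (L ⋆ series H′ x ⊕ series H x) E.- (E.1# ⊕ L) ⋆ (series H′ 0# ⋆ series H x)

    L⋆L⁻¹≈1 : L ⋆ scalar lamInv ≋ E.1#
    L⋆L⁻¹≈1 = E.trans (scalar-⋆-scalar lam lamInv) (scalar-cong inv)

    eqH′ : ∀ y → u ⋆ series H′ y ≋ (L E.- E.1#) ⋆ powers y
    eqH′ y = rescale-by-inverse {L} {scalar lamInv} {ones} {powers y} {series H′ y}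
               L⋆L⁻¹≈1 (isFrobeniusEuler⇒egf isFE′ y)

    eqh′ : u ⋆ series H′ 0# ≋ L E.- E.1#
    eqh′ = E.trans (eqH′ 0#) (E.trans (⋆-congˡ {a = L E.- E.1#} powers-0) (E.*-identityʳ _))

    uvD≈0 : u ⋆ (v ⋆ D) ≋ E.0#
    uvD≈0 = annihilate-product-formula {L} {ones} {powers x} {series H x} {series H′ x} {series H′ 0#}
      (isFrobeniusEuler⇒egf isFE x) (eqH′ x) eqh′

    invertible : ∀ {w a} → w 0 ≈ a → ¬ (a ≈ 0#) → Σ Carrier (λ b → w 0 * b ≈ 1#)
    invertible w₀≈a a≉0 with inverse _ a≉0
    ... | b , ab≈1 = b , trans (*-congʳ w₀≈a) ab≈1

    u-invertible : Σ Carrier (λ b → u 0 * b ≈ 1#)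
    u-invertible = invertible {w = u} (+-congʳ (trans (⋆-head L ones) (*-identityʳ lam)))
                              (λ lam-1≈0 → lam≉1 (x-y≈0⇒x≈y lam 1# lam-1≈0))

    v-invertible : Σ Carrier (λ b → v 0 * b ≈ 1#)
    v-invertible = invertible {w = v} refl (λ 1-lam≈0 → lam≉1 (sym (x-y≈0⇒x≈y 1# lam 1-lam≈0)))

    D≈0 : D ≋ E.0#
    D≈0 = w⋆d≈0⇒d≈0 {v} {D} v-invertible (w⋆d≈0⇒d≈0 {u} {v ⋆ D} u-invertible uvD≈0)

theorem2 : ∀ {c ℓ} (R : CommutativeRing c ℓ) →
    let open CommutativeRing R in let open FE R in
    IsCharZeroField →
    (lam lamInv : Carrier) → lam * lamInv ≈ 1# →
    ¬ (lam ≈ 0#) → ¬ (lam ≈ 1#) →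
    (H H' : ℕ → Carrier → Carrier) →
    IsFrobeniusEuler lam H → IsFrobeniusEuler lamInv H' →
    (n : ℕ) (x : Carrier) →
    lam * H' n x + H n x
      ≈ (1# + lam) * sumTo n (λ k → fromℕ (n C k) * (H' (n ∸ k) 0# * H k x))
theorem2 R (_ , inverse , _) lam lamInv inv _ lam≉1 H H′ isFE isFE′ n x = begin
  lam * H′ n x + H n x                                 ≈⟨ +-congʳ (scalar-⋆ lam (series H′ x) n) ⟨
  (scalar lam ⋆ series H′ x ⊕ series H x) n            ≈⟨ product-formula-egf inverse inv lam≉1 isFE isFE′ x n ⟩
  (scalar (1# + lam) ⋆ (series H′ 0# ⋆ series H x)) n  ≈⟨ scalar-⋆ (1# + lam) (series H′ 0# ⋆ series H x) n ⟩
  (1# + lam) * sumTo n (λ k → fromℕ (n C k) * (H′ (n ∸ k) 0# * H k x)) ∎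
  where
  open CommutativeRing R
  open FE R
  open ExponentialSeries R
  open FrobeniusEulerSeries R
  open import Relation.Binary.Reasoning.Setoid setoid
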